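{- The snare and every $n$-nova with $n \geq 2$ are $2$-connected graphs with no Hamiltonian cycle.
   Context: A Hamiltonian cycle of a graph $G$ is a (not necessarily induced) subgraph of $G$ which is a cycle containing every vertex of $G$. The net is the graph with vertex set $\{a,b,c,a',b',c'\}$ and edge set $\{a'b', b'c', a'c', aa', bb', cc'\}$. The snare is the graph obtained from the net by adding a vertex adjacent to every vertex of the net. For $n \geq 2$, an $n$-sun is the graph obtained from a cycle $C$ with $2n$ vertices $v_1,\dots,v_{2n}$ in this order along $C$ by adding all edges $v_{2i}v_{2j}$ for distinct $i,j \in \{1,\dots,n\}$; an $n$-nova is obtained from an $n$-sun by adding a new vertex $w$ and the edges $wv_{2i}$ for all $i \in \{1,\dots,n\}$. -}

module Defs where

open import Data.Nat using (ℕ; zero; suc; _+_; _*_; _≤_; _<_; _%_)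
open import Data.Fin using (Fin; toℕ)
open import Data.Product using (Σ; _×_; _,_)
open import Data.Sum using (_⊎_)
open import Data.Unit using (⊤)
open import Data.List using (List; []; _∷_; _++_; length)
open import Data.List.Membership.Propositional using (_∈_)
open import Data.List.Relation.Unary.Unique.Propositional using (Unique)
open import Data.List.Relation.Unary.Linked using (Linked)
open import Relation.Binary.PropositionalEquality using (_≡_; _≢_)

record Graph : Set₁ where
  field
    order : ℕ
    Adj   : Fin order → Fin order → Set
    sym   : ∀ {x y} → Adj x y → Adj y x
    irrefl : ∀ {x y} → Adj x y → x ≢ y
open Graph public

mkGraph : (n : ℕ) → (Fin n → Fin n → Set) → Graph
mkGraph n E = record
  { order = n
  ; Adj = λ x y → x ≢ y × (E x y ⊎ E y x)
  ; sym = λ { (ne , Data.Sum.inj₁ e) → (λ eq → ne (Relation.Binary.PropositionalEquality.sym eq)) , Data.Sum.inj₂ e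
            ; (ne , Data.Sum.inj₂ e) → (λ eq → ne (Relation.Binary.PropositionalEquality.sym eq)) , Data.Sum.inj₁ e }
  ; irrefl = λ { (ne , _) → ne }
  }

data Walk (G : Graph) (P : Fin (order G) → Set) : Fin (order G) → Fin (order G) → Set where
  here  : ∀ {x} → P x → Walk G P x x
  step  : ∀ {x y z} → P x → Adj G x y → Walk G P y z → Walk G P x z

Connected : Graph → Set
Connected G = ∀ x y → Walk G (λ _ → ⊤) x y

ConnectedWithout : (G : Graph) → Fin (order G) → Set
ConnectedWithout G v = ∀ x y → x ≢ v → y ≢ v → Walk G (λ u → u ≢ v) x y

TwoConnected : Graph → Set
TwoConnected G = 3 ≤ order G × Connected G × (∀ v → ConnectedWithout G v)

HamiltonianCycle : Graph → Set
HamiltonianCycle G =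
  Σ (Fin (order G)) λ x → Σ (List (Fin (order G))) λ xs →
    2 ≤ length xs × Unique (x ∷ xs) × (∀ v → v ∈ x ∷ xs) × Linked (Adj G) (x ∷ xs ++ x ∷ [])

-- Snare: net vertices a,b,c,a',b',c' = 0,1,2,3,4,5 and the extra vertex 6.
snareE : Fin 7 → Fin 7 → Set
snareE x y = (toℕ x , toℕ y) ∈ edges
  where
  edges : List (ℕ × ℕ)
  edges = (3 , 4) ∷ (4 , 5) ∷ (3 , 5) ∷ (0 , 3) ∷ (1 , 4) ∷ (2 , 5)
        ∷ (6 , 0) ∷ (6 , 1) ∷ (6 , 2) ∷ (6 , 3) ∷ (6 , 4) ∷ (6 , 5) ∷ []

snare : Graph
snare = mkGraph 7 snareE

-- n-nova on Fin (2n+1): index k < 2n stands for v_{k+1}; index 2n is w.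
-- The vertices v_{2i} are those with odd index.
novaE : (n : ℕ) → Fin (suc (2 * n)) → Fin (suc (2 * n)) → Set
novaE n x y =
    (suc a ≡ b × b < 2 * n)                           -- cycle edges v_{a+1} v_{a+2}
  ⊎ (b ≡ 0 × suc a ≡ 2 * n)                           -- cycle edge v_{2n} v_1
  ⊎ (a < 2 * n × b < 2 * n × a % 2 ≡ 1 × b % 2 ≡ 1)  -- clique on v_2, v_4, …, v_{2n}
  ⊎ (a ≡ 2 * n × b % 2 ≡ 1)                           -- w adjacent to v_2, …, v_{2n}
  where
  a = toℕ x
  b = toℕ y

nova : ℕ → Graph
nova n = mkGraph (suc (2 * n)) (novaE n)

-- Both graphs contain a clique K (in the snare the triangle a′b′c′ together with the centre, in the
-- n-nova the vertices v₂, v₄, …, v₂ₙ) and every vertex outside K has two neighbours in K; after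
-- deleting any one vertex, each remaining vertex therefore still reaches K, so there is no cut vertex.
-- The n-nova has 2n + 1 vertices but the vertex cover {v₂, …, v₂ₙ} of size n, whereas every vertex
-- outside a cover is followed on a Hamiltonian cycle by one inside it, so a cover of a Hamiltonian
-- graph contains at least half of its vertices. In the snare, a, b and c have degree two and are all
-- adjacent to the centre, so a Hamiltonian cycle would use three edges at the centre.

module Submission where

open import Defs hiding (sym)
open import Data.Nat as ℕ using (ℕ; zero; suc; _+_; _*_; _≤_; _<_; _%_; _/_; _≤?_; _<?_; z≤n; s≤s; s≤s⁻¹)
open import Data.Nat.Properties
  using ( module ≤-Reasoning; +-suc; +-mono-≤; +-monoʳ-≤; +-identityʳ; *-comm; *-monoʳ-≤; *-monoʳ-<
        ; *-cancelˡ-<; ≤-refl; ≤-trans; ≤-reflexive; <-trans; <-irrefl; <⇒≢; ≤∧≢⇒<; n<1+n; 1+n≢n; 0≢1+n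
        ; m<n⇒m<1+n; m≤n⇒m<n∨m≡n; m≤n⇒∃[o]m+o≡n )
open import Data.Nat.DivMod using (m≡m%n+[m/n]*n; m*n%n≡0)
open import Data.Fin using (Fin; zero; suc; toℕ; fromℕ<; #_; _≟_)
open import Data.Fin.Properties using (toℕ-fromℕ<; toℕ-injective; toℕ<n; all?; any?)
open import Data.Product using (Σ; _×_; _,_; map₁; proj₁; proj₂)
import Data.Product as Prod
import Data.Product.Properties as Product
open import Data.Sum using (_⊎_; inj₁; inj₂)
import Data.Sum as Sum
open import Data.Unit using (tt)
open import Data.Empty using (⊥-elim)
open import Function using (id)
open import Data.List using (List; []; _∷_; _++_; [_]; length; filter; map; allFin)
open import Data.List.Properties
  using ( length-++; length-++-sucʳ; length-++-comm; length-map; length-tabulate; ∷-injectiveˡ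
        ; ∷ʳ-injectiveʳ; filter-++; ++-assoc )
open import Data.List.Membership.Propositional using (_∈_)
open import Data.List.Membership.Propositional.Properties
  using (∈-∃++; ∈-++⁻; ∈-++⁺ˡ; ∈-++⁺ʳ; ∈-filter⁻; ∈-map⁺; ∈-allFin)
open import Data.List.Membership.DecPropositional (Product.≡-dec ℕ._≟_ ℕ._≟_) using (_∈?_)
open import Data.List.Relation.Unary.Any using (here; there)
open import Data.List.Relation.Unary.All as All using (All; _∷_)
open import Data.List.Relation.Unary.AllPairs using (_∷_)
open import Data.List.Relation.Unary.Linked using (Linked; []; [-]; _∷_)
open import Data.List.Relation.Unary.Unique.Propositional using (Unique)
open import Data.List.Relation.Unary.Unique.Propositional.Properties using (allFin⁺; filter⁺)
open import Data.List.Relation.Binary.Permutation.Propositional using (_↭_; ↭⇒↭ₛ)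
open import Data.List.Relation.Binary.Permutation.Propositional.Properties using (++-comm; ∈-resp-↭)
import Data.List.Relation.Binary.Permutation.Setoid.Properties as Permutationₛ
open import Relation.Nullary using (Dec; yes; no; ¬_; ¬?)
open import Relation.Nullary.Decidable using (from-yes; _×-dec_; _⊎-dec_; _→-dec_)
open import Relation.Unary using (Pred; Decidable)
open import Relation.Unary.Properties using (∁?)
open import Relation.Binary.PropositionalEquality
  using (_≡_; _≢_; refl; sym; trans; cong; cong₂; subst; setoid; module ≡-Reasoning)

module _ {A : Set} where

  length-filter-∁ : ∀ {ℓ} {P : Pred A ℓ} (P? : Decidable P) xs →
                    length (filter P? xs) + length (filter (∁? P?) xs) ≡ length xs
  length-filter-∁ P? [] = refl
  length-filter-∁ P? (x ∷ xs) with P? x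
  ... | yes _ = cong suc (length-filter-∁ P? xs)
  ... | no _  = trans (+-suc _ _) (cong suc (length-filter-∁ P? xs))

  length-filter-∷ : ∀ {ℓ} {P : Pred A ℓ} (P? : Decidable P) x xs →
                    length (filter P? (x ∷ xs)) ≡ length (filter P? [ x ]) + length (filter P? xs)
  length-filter-∷ P? x xs = trans (cong length (filter-++ P? [ x ] xs)) (length-++ (filter P? [ x ]))

  length-filter-rotate : ∀ {ℓ} {P : Pred A ℓ} (P? : Decidable P) x xs →
                         length (filter P? (xs ++ [ x ])) ≡ length (filter P? (x ∷ xs))
  length-filter-rotate P? x xs = begin
    length (filter P? (xs ++ [ x ]))          ≡⟨ cong length (filter-++ P? xs [ x ]) ⟩
    length (filter P? xs ++ filter P? [ x ])  ≡⟨ length-++-comm (filter P? xs) _ ⟩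
    length (filter P? [ x ] ++ filter P? xs)  ≡⟨ cong length (filter-++ P? [ x ] xs) ⟨
    length (filter P? (x ∷ xs))               ∎
    where open ≡-Reasoning

  Unique-⊆⇒length≤ : ∀ {xs ys : List A} → Unique xs → (∀ {z} → z ∈ xs → z ∈ ys) → length xs ≤ length ys
  Unique-⊆⇒length≤ {[]} _ _ = z≤n
  Unique-⊆⇒length≤ {x ∷ xs} (x∉xs ∷ unique) xs⊆ys with pre , post , refl ← ∈-∃++ (xs⊆ys (here refl)) =
    subst (suc (length xs) ≤_) (sym (length-++-sucʳ pre x post)) (s≤s (Unique-⊆⇒length≤ unique xs⊆pre++post))
    where
    xs⊆pre++post : ∀ {z} → z ∈ xs → z ∈ pre ++ post
    xs⊆pre++post z∈xs with ∈-++⁻ pre (xs⊆ys (there z∈xs))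
    ... | inj₁ z∈pre          = ∈-++⁺ˡ z∈pre
    ... | inj₂ (here z≡x)     = ⊥-elim (All.lookup x∉xs z∈xs (sym z≡x))
    ... | inj₂ (there z∈post) = ∈-++⁺ʳ pre z∈post

  Linked-split : ∀ {R : A → A → Set} xs {y ys} →
                 Linked R (xs ++ y ∷ ys) → Linked R (xs ++ [ y ]) × Linked R (y ∷ ys)
  Linked-split []            l       = [-] , l
  Linked-split (x ∷ [])      (r ∷ l) = r ∷ [-] , l
  Linked-split (x ∷ x′ ∷ xs) (r ∷ l) = map₁ (r ∷_) (Linked-split (x′ ∷ xs) l)

  Linked-join : ∀ {R : A → A → Set} xs {y ys} →
                Linked R (xs ++ [ y ]) → Linked R (y ∷ ys) → Linked R (xs ++ y ∷ ys)
  Linked-join []            _        l = l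
  Linked-join (x ∷ [])      (r ∷ _)  l = r ∷ l
  Linked-join (x ∷ x′ ∷ xs) (r ∷ l′) l = r ∷ Linked-join (x′ ∷ xs) l′ l

  rotate-closed : ∀ {R : A → A → Set} {x xs v} → Linked R (x ∷ xs ++ [ x ]) → v ∈ x ∷ xs →
                  Σ (List A) λ ys → (x ∷ xs) ↭ (v ∷ ys) × Linked R (v ∷ ys ++ [ v ])
  rotate-closed {xs = xs} closed (here refl) = xs , _↭_.refl , closed
  rotate-closed {R = R} {x} closed (there v∈xs) with pre , post , refl ← ∈-∃++ v∈xs =
    post ++ x ∷ pre , ++-comm (x ∷ pre) (_ ∷ post) ,
    subst (Linked R) (sym (++-assoc (_ ∷ post) (x ∷ pre) [ _ ])) (Linked-join (_ ∷ post) back front)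
    where
    halves = Linked-split (x ∷ pre) (subst (Linked R) (cong (x ∷_) (++-assoc pre (_ ∷ post) [ x ])) closed)
    front = proj₁ halves
    back  = proj₂ halves

  AtEnd : A → List A → Set
  AtEnd x ys = (Σ (List A) λ zs → ys ≡ x ∷ zs) ⊎ (Σ (List A) λ zs → ys ≡ zs ++ [ x ])

  three-AtEnd⇒two-equal : ∀ {a b c ys} → AtEnd a ys → AtEnd b ys → AtEnd c ys → a ≡ b ⊎ a ≡ c ⊎ b ≡ c
  three-AtEnd⇒two-equal (inj₁ (_ , ea))  (inj₁ (_ , eb))   _ = inj₁ (∷-injectiveˡ (trans (sym ea) eb))
  three-AtEnd⇒two-equal (inj₂ (zs , ea)) (inj₂ (zs′ , eb)) _ = inj₁ (∷ʳ-injectiveʳ zs zs′ (trans (sym ea) eb))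
  three-AtEnd⇒two-equal (inj₁ (_ , ea))  (inj₂ _) (inj₁ (_ , ec)) = inj₂ (inj₁ (∷-injectiveˡ (trans (sym ea) ec)))
  three-AtEnd⇒two-equal (inj₁ _) (inj₂ (zs , eb)) (inj₂ (zs′ , ec)) =
    inj₂ (inj₂ (∷ʳ-injectiveʳ zs zs′ (trans (sym eb) ec)))
  three-AtEnd⇒two-equal (inj₂ (zs , ea)) (inj₁ _) (inj₂ (zs′ , ec)) =
    inj₂ (inj₁ (∷ʳ-injectiveʳ zs zs′ (trans (sym ea) ec)))
  three-AtEnd⇒two-equal (inj₂ _) (inj₁ (_ , eb)) (inj₁ (_ , ec)) = inj₂ (inj₂ (∷-injectiveˡ (trans (sym eb) ec)))

module _ {A : Set} {ℓ} {R : A → A → Set} {C : Pred A ℓ} (C? : Decidable C)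
         (cover : ∀ {x y} → R x y → C x ⊎ C y) where

  length-filter-∁-≤-adjacent : ∀ {z w} → R z w → length (filter (∁? C?) [ z ]) ≤ length (filter C? [ w ])
  length-filter-∁-≤-adjacent {z} {w} r with C? z | C? w
  ... | yes _  | _      = z≤n
  ... | no _   | yes _  = ≤-refl
  ... | no ¬Cz | no ¬Cw = ⊥-elim (Sum.[ ¬Cz , ¬Cw ] (cover r))

  length-filter-∁-≤-next : ∀ z zs y → Linked R (z ∷ zs ++ [ y ]) →
                           length (filter (∁? C?) (z ∷ zs)) ≤ length (filter C? (zs ++ [ y ]))
  length-filter-∁-≤-next z []       y (r ∷ _) = length-filter-∁-≤-adjacent r
  length-filter-∁-≤-next z (w ∷ ws) y (r ∷ l) = begin
    length (filter (∁? C?) (z ∷ w ∷ ws))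
      ≡⟨ length-filter-∷ (∁? C?) z (w ∷ ws) ⟩
    length (filter (∁? C?) [ z ]) + length (filter (∁? C?) (w ∷ ws))
      ≤⟨ +-mono-≤ (length-filter-∁-≤-adjacent r) (length-filter-∁-≤-next w ws y l) ⟩
    length (filter C? [ w ]) + length (filter C? (ws ++ [ y ]))
      ≡⟨ length-filter-∷ C? w (ws ++ [ y ]) ⟨
    length (filter C? (w ∷ ws ++ [ y ]))
      ∎
    where open ≤-Reasoning

∃-avoiding-two : ∀ {n} → 3 ≤ n → (x y : Fin n) → Σ (Fin n) λ v → x ≢ v × y ≢ v
∃-avoiding-two (s≤s (s≤s (s≤s _))) zero          zero          = suc zero , (λ ()) , (λ ())
∃-avoiding-two (s≤s (s≤s (s≤s _))) zero          (suc zero)    = suc (suc zero) , (λ ()) , (λ ())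
∃-avoiding-two (s≤s (s≤s (s≤s _))) zero          (suc (suc _)) = suc zero , (λ ()) , (λ ())
∃-avoiding-two (s≤s (s≤s (s≤s _))) (suc zero)    zero          = suc (suc zero) , (λ ()) , (λ ())
∃-avoiding-two (s≤s (s≤s (s≤s _))) (suc (suc _)) zero          = suc zero , (λ ()) , (λ ())
∃-avoiding-two (s≤s (s≤s (s≤s _))) (suc _)       (suc _)       = zero , (λ ()) , (λ ())

module _ {G : Graph} where

  private
    V = Fin (order G)

  mapWalk : ∀ {P Q : V → Set} {x y} → (∀ {u} → P u → Q u) → Walk G P x y → Walk G Q x y
  mapWalk f (here px)     = here (f px)
  mapWalk f (step px a w) = step (f px) a (mapWalk f w)

  noCutVertex⇒twoConnected : 3 ≤ order G → (∀ v → ConnectedWithout G v) → TwoConnected G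
  noCutVertex⇒twoConnected 3≤n noCut = 3≤n , connected , noCut
    where
    connected : Connected G
    connected x y with v , x≢v , y≢v ← ∃-avoiding-two 3≤n x y = mapWalk (λ _ → tt) (noCut v x y x≢v y≢v)

  IsClique : (V → Set) → Set
  IsClique K = ∀ {a b} → K a → K b → a ≢ b → Adj G a b

  Reaches : (V → Set) → V → V → Set
  Reaches K v x = Σ V λ o → K o × o ≢ v × (o ≡ x ⊎ Adj G x o)

  connectedWithout-viaClique : ∀ {K} v → IsClique K → (∀ x → x ≢ v → Reaches K v x) → ConnectedWithout G v
  connectedWithout-viaClique v clique reach x y x≢v y≢v
    with a , Ka , a≢v , x~a ← reach x x≢v | b , Kb , b≢v , y~b ← reach y y≢v =
    enter x~a (across (leave y~b))
    where
    leave : b ≡ y ⊎ Adj G y b → Walk G (_≢ v) b y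
    leave (inj₁ refl) = here b≢v
    leave (inj₂ y~b)  = step b≢v (Graph.sym G y~b) (here y≢v)
    across : Walk G (_≢ v) b y → Walk G (_≢ v) a y
    across w with a ≟ b
    ... | yes refl = w
    ... | no a≢b   = step a≢v (clique Ka Kb a≢b) w
    enter : a ≡ x ⊎ Adj G x a → Walk G (_≢ v) a y → Walk G (_≢ v) x y
    enter (inj₁ refl) w = w
    enter (inj₂ x~a)  w = step x≢v x~a w

  TwoNeighboursIn : (V → Set) → V → Set
  TwoNeighboursIn K x = Σ V λ u → Σ V λ w → u ≢ w × (K u × Adj G x u) × (K w × Adj G x w)

  noCutVertex-viaClique : ∀ {K} → IsClique K → (∀ x → K x ⊎ TwoNeighboursIn K x) → ∀ v → ConnectedWithout G v
  noCutVertex-viaClique {K} clique K⊎twoNeighbours v = connectedWithout-viaClique v clique reach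
    where
    reach : ∀ x → x ≢ v → Reaches K v x
    reach x x≢v with K⊎twoNeighbours x
    ... | inj₁ Kx = x , Kx , x≢v , inj₁ refl
    ... | inj₂ (u , w , u≢w , (Ku , x~u) , (Kw , x~w)) with u ≟ v
    ...   | yes refl = w , Kw , (λ w≡u → u≢w (sym w≡u)) , inj₂ x~w
    ...   | no u≢v   = u , Ku , u≢v , inj₂ x~u

  HamiltonianCycleFrom : V → Set
  HamiltonianCycleFrom v =
    Σ (List V) λ ys → Unique (v ∷ ys) × (∀ u → u ∈ v ∷ ys) × Linked (Adj G) (v ∷ ys ++ [ v ])

  hamiltonianCycleFrom : HamiltonianCycle G → ∀ v → HamiltonianCycleFrom v
  hamiltonianCycleFrom (x , xs , _ , unique , covers , closed) v
    with ys , σ , closed′ ← rotate-closed closed (covers v) =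
    ys , Permutationₛ.Unique-resp-↭ (setoid V) (↭⇒↭ₛ σ) unique , (λ u → ∈-resp-↭ σ (covers u)) , closed′

  -- Every vertex outside the cover is followed on the cycle by a vertex of the cover.
  order≤2*length-cover : ∀ {ℓ} {C : V → Set ℓ} (C? : Decidable C) → (∀ {x y} → Adj G x y → C x ⊎ C y) →
                         (cs : List V) → (∀ {x} → C x → x ∈ cs) → HamiltonianCycle G → order G ≤ 2 * length cs
  order≤2*length-cover C? cover cs C⊆cs (x , xs , _ , unique , covers , closed) = begin
    order G                      ≡⟨ length-tabulate id ⟨
    length (allFin (order G))    ≤⟨ Unique-⊆⇒length≤ (allFin⁺ _) (λ {v} _ → covers v) ⟩
    length (x ∷ xs)              ≡⟨ length-filter-∁ C? (x ∷ xs) ⟨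
    #C + length (filter (∁? C?) (x ∷ xs))
                                 ≤⟨ +-monoʳ-≤ #C #∁C≤#C ⟩
    #C + #C                      ≤⟨ +-mono-≤ #C≤length-cs #C≤length-cs ⟩
    length cs + length cs        ≡⟨ cong (length cs +_) (+-identityʳ _) ⟨
    2 * length cs                ∎
    where
    open ≤-Reasoning
    #C = length (filter C? (x ∷ xs))
    #∁C≤#C : length (filter (∁? C?) (x ∷ xs)) ≤ #C
    #∁C≤#C = ≤-trans (length-filter-∁-≤-next C? cover x xs x closed) (≤-reflexive (length-filter-rotate C? x xs))
    #C≤length-cs : #C ≤ length cs
    #C≤length-cs = Unique-⊆⇒length≤ (filter⁺ C? unique) (λ v∈ → C⊆cs (proj₂ (∈-filter⁻ C? v∈)))

  NeighboursWithin : V → V → V → Set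
  NeighboursWithin d h p = ∀ {y} → Adj G d y → y ≡ h ⊎ y ≡ p

  -- An interior vertex d of the path ys would have two distinct neighbours on it, both different
  -- from h and hence both equal to p.
  NeighboursWithin⇒AtEnd : ∀ {h p d} ys → Unique (h ∷ ys) → Linked (Adj G) (h ∷ ys ++ [ h ]) →
                           NeighboursWithin d h p → d ∈ ys → AtEnd d ys
  NeighboursWithin⇒AtEnd (y ∷ ys) _ _ _ (here refl) = inj₁ (ys , refl)
  NeighboursWithin⇒AtEnd {h} {p} {d} (y ∷ ys) (h∉ ∷ unique) (_ ∷ closed) neighbours (there d∈ys) =
    inj₂ (Prod.map (y ∷_) (cong (y ∷_)) (last y ys closed unique h∉ d∈ys))
    where
    neighbour≡p : ∀ {y} → h ≢ y → Adj G d y → y ≡ p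
    neighbour≡p h≢y d~y with neighbours d~y
    ... | inj₁ y≡h = ⊥-elim (h≢y (sym y≡h))
    ... | inj₂ y≡p = y≡p
    last : ∀ u zs → Linked (Adj G) (u ∷ zs ++ [ h ]) → Unique (u ∷ zs) → All (h ≢_) (u ∷ zs) →
           d ∈ zs → Σ (List V) λ pre → zs ≡ pre ++ [ d ]
    last u (z ∷ []) _ _ _ (here refl) = [] , refl
    last u (z ∷ w ∷ ws) (u~d ∷ d~w ∷ _) ((_ ∷ u≢w ∷ _) ∷ _) (h≢u ∷ _ ∷ h≢w ∷ _) (here refl) =
      ⊥-elim (u≢w (trans (neighbour≡p h≢u (Graph.sym G u~d)) (sym (neighbour≡p h≢w d~w))))
    last u (z ∷ zs) (_ ∷ closed) (_ ∷ unique) (_ ∷ h∉) (there d∈zs) =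
      Prod.map (z ∷_) (cong (z ∷_)) (last z zs closed unique h∉ d∈zs)

  three-NeighboursWithin⇒¬Hamiltonian : ∀ {h d₁ d₂ d₃ p₁ p₂ p₃} →
    d₁ ≢ h → d₂ ≢ h → d₃ ≢ h → d₁ ≢ d₂ → d₁ ≢ d₃ → d₂ ≢ d₃ →
    NeighboursWithin d₁ h p₁ → NeighboursWithin d₂ h p₂ → NeighboursWithin d₃ h p₃ → ¬ HamiltonianCycle G
  three-NeighboursWithin⇒¬Hamiltonian {h} d₁≢h d₂≢h d₃≢h d₁≢d₂ d₁≢d₃ d₂≢d₃ nbrs₁ nbrs₂ nbrs₃ ham
    with ys , unique , covers , closed ← hamiltonianCycleFrom ham h =
    Sum.[ d₁≢d₂ , Sum.[ d₁≢d₃ , d₂≢d₃ ] ]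
      (three-AtEnd⇒two-equal (atEnd d₁≢h nbrs₁) (atEnd d₂≢h nbrs₂) (atEnd d₃≢h nbrs₃))
    where
    atEnd : ∀ {d p} → d ≢ h → NeighboursWithin d h p → AtEnd d ys
    atEnd {d} d≢h neighbours with covers d
    ... | here d≡h   = ⊥-elim (d≢h d≡h)
    ... | there d∈ys = NeighboursWithin⇒AtEnd ys unique closed neighbours d∈ys

-- The snare

-- The edge list of snareE once more, so that adjacency can be decided; the type of edge? checks
-- that it is the same list.
snareEdges : List (ℕ × ℕ)
snareEdges = (3 , 4) ∷ (4 , 5) ∷ (3 , 5) ∷ (0 , 3) ∷ (1 , 4) ∷ (2 , 5)
           ∷ (6 , 0) ∷ (6 , 1) ∷ (6 , 2) ∷ (6 , 3) ∷ (6 , 4) ∷ (6 , 5) ∷ []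

snareAdj? : ∀ x y → Dec (Adj snare x y)
snareAdj? x y = ¬? (x ≟ y) ×-dec (edge? x y ⊎-dec edge? y x)
  where
  edge? : ∀ x y → Dec (snareE x y)
  edge? x y = (toℕ x , toℕ y) ∈? snareEdges

-- a′, b′, c′ and the centre, which span a K₄
Core : Fin 7 → Set
Core x = 3 ≤ toℕ x

core? : ∀ x → Dec (Core x)
core? x = 3 ≤? toℕ x

core-isClique : IsClique {snare} Core
core-isClique {a} {b} = clique a b
  where
  clique : ∀ a b → Core a → Core b → a ≢ b → Adj snare a b
  clique = from-yes (all? λ a → all? λ b → core? a →-dec core? b →-dec ¬? (a ≟ b) →-dec snareAdj? a b)

core⊎twoNeighbours : ∀ x → Core x ⊎ TwoNeighboursIn {snare} Core x
core⊎twoNeighbours = from-yes (all? λ x → core? x ⊎-dec any? λ u → any? λ w →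
  ¬? (u ≟ w) ×-dec (core? u ×-dec snareAdj? x u) ×-dec (core? w ×-dec snareAdj? x w))

snare-twoConnected : TwoConnected snare
snare-twoConnected =
  noCutVertex⇒twoConnected (s≤s (s≤s (s≤s z≤n))) (noCutVertex-viaClique core-isClique core⊎twoNeighbours)

neighboursWithin-centre : ∀ d p → (∀ y → Adj snare d y → y ≡ # 6 ⊎ y ≡ p) → NeighboursWithin {snare} d (# 6) p
neighboursWithin-centre d p neighbours {y} = neighbours y

snare-¬Hamiltonian : ¬ HamiltonianCycle snare
snare-¬Hamiltonian = three-NeighboursWithin⇒¬Hamiltonian {snare}
  (λ ()) (λ ()) (λ ()) (λ ()) (λ ()) (λ ())
  (neighboursWithin-centre (# 0) (# 3) (from-yes (all? λ y → snareAdj? (# 0) y →-dec (y ≟ # 6 ⊎-dec y ≟ # 3))))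
  (neighboursWithin-centre (# 1) (# 4) (from-yes (all? λ y → snareAdj? (# 1) y →-dec (y ≟ # 6 ⊎-dec y ≟ # 4))))
  (neighboursWithin-centre (# 2) (# 5) (from-yes (all? λ y → snareAdj? (# 2) y →-dec (y ≟ # 6 ⊎-dec y ≟ # 5))))

-- Novas

-- suc (suc a) % 2 reduces to a % 2, so parity facts follow by plain recursion.
parity : ∀ a → a % 2 ≡ 0 ⊎ a % 2 ≡ 1
parity zero          = inj₁ refl
parity (suc zero)    = inj₂ refl
parity (suc (suc a)) = parity a

even⇒suc-odd : ∀ a → a % 2 ≡ 0 → suc a % 2 ≡ 1
even⇒suc-odd zero          _ = refl
even⇒suc-odd (suc (suc a))   = even⇒suc-odd a

suc-even⇒odd : ∀ a → suc a % 2 ≡ 0 → a % 2 ≡ 1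
suc-even⇒odd a 1+a-even with parity a
... | inj₁ a-even with () ← trans (sym 1+a-even) (even⇒suc-odd a a-even)
... | inj₂ a-odd = a-odd

2*-even : ∀ m → (2 * m) % 2 ≡ 0
2*-even m = trans (cong (_% 2) (*-comm 2 m)) (m*n%n≡0 m 2)

odd≢2* : ∀ {a} m → a % 2 ≡ 1 → a ≢ 2 * m
odd≢2* m a-odd refl with () ← trans (sym a-odd) (2*-even m)

odd⇒≡suc-2*half : ∀ {a} → a % 2 ≡ 1 → a ≡ suc (2 * (a / 2))
odd⇒≡suc-2*half {a} a-odd = trans (m≡m%n+[m/n]*n a 2) (cong₂ _+_ a-odd (*-comm (a / 2) 2))

-- novaE n x y unfolds to NovaEdge n (toℕ x) (toℕ y); stated on ℕ, edges can be transported along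
-- equations between indices.
NovaEdge : ℕ → ℕ → ℕ → Set
NovaEdge n a b =
    (suc a ≡ b × b < 2 * n)
  ⊎ (b ≡ 0 × suc a ≡ 2 * n)
  ⊎ (a < 2 * n × b < 2 * n × a % 2 ≡ 1 × b % 2 ≡ 1)
  ⊎ (a ≡ 2 * n × b % 2 ≡ 1)

module Nova (n : ℕ) where

  private
    V = Fin (suc (2 * n))
    G = nova n

  Rim : V → Set
  Rim x = toℕ x < 2 * n × toℕ x % 2 ≡ 1

  rim? : ∀ x → Dec (Rim x)
  rim? x = toℕ x <? 2 * n ×-dec toℕ x % 2 ℕ.≟ 1

  rim-isClique : IsClique {G} Rim
  rim-isClique (a<2n , a-odd) (b<2n , b-odd) a≢b = a≢b , inj₁ (inj₂ (inj₂ (inj₁ (a<2n , b<2n , a-odd , b-odd))))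

  edge-meets-rim : ∀ {x y} → NovaEdge n (toℕ x) (toℕ y) → Rim x ⊎ Rim y
  edge-meets-rim {x} (inj₁ (1+x≡y , y<2n)) with parity (toℕ x)
  ... | inj₁ x-even = inj₂ (y<2n , subst (λ b → b % 2 ≡ 1) 1+x≡y (even⇒suc-odd (toℕ x) x-even))
  ... | inj₂ x-odd  = inj₁ (<-trans (≤-reflexive 1+x≡y) y<2n , x-odd)
  edge-meets-rim {x} (inj₂ (inj₁ (_ , 1+x≡2n))) =
    inj₁ (≤-reflexive 1+x≡2n , suc-even⇒odd (toℕ x) (subst (λ a → a % 2 ≡ 0) (sym 1+x≡2n) (2*-even n)))
  edge-meets-rim (inj₂ (inj₂ (inj₁ (x<2n , _ , x-odd , _)))) = inj₁ (x<2n , x-odd)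
  edge-meets-rim {y = y} (inj₂ (inj₂ (inj₂ (_ , y-odd)))) =
    inj₂ (≤∧≢⇒< (s≤s⁻¹ (toℕ<n y)) (odd≢2* n y-odd) , y-odd)

  adj-meets-rim : ∀ {x y} → Adj G x y → Rim x ⊎ Rim y
  adj-meets-rim (_ , inj₁ e) = edge-meets-rim e
  adj-meets-rim (_ , inj₂ e) = Sum.swap (edge-meets-rim e)

  rimVertex : Fin n → V
  rimVertex j = fromℕ< (s≤s (*-monoʳ-< 2 (toℕ<n j)))

  rimVertices : List V
  rimVertices = map rimVertex (allFin n)

  length-rimVertices : length rimVertices ≡ n
  length-rimVertices = trans (length-map rimVertex (allFin n)) (length-tabulate _)

  rim⊆rimVertices : ∀ {x} → Rim x → x ∈ rimVertices
  rim⊆rimVertices {x} (x<2n , x-odd) =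
    subst (_∈ rimVertices) rimVertex-half≡x (∈-map⁺ rimVertex (∈-allFin (fromℕ< half<n)))
    where
    x≡1+2*half : toℕ x ≡ suc (2 * (toℕ x / 2))
    x≡1+2*half = odd⇒≡suc-2*half x-odd
    half<n : toℕ x / 2 < n
    half<n = *-cancelˡ-< 2 _ _ (<-trans (n<1+n _) (subst (_< 2 * n) x≡1+2*half x<2n))
    rimVertex-half≡x : rimVertex (fromℕ< half<n) ≡ x
    rimVertex-half≡x = toℕ-injective (begin
      toℕ (rimVertex (fromℕ< half<n))  ≡⟨ toℕ-fromℕ< (s≤s (*-monoʳ-< 2 (toℕ<n (fromℕ< half<n)))) ⟩
      suc (2 * toℕ (fromℕ< half<n))    ≡⟨ cong (λ j → suc (2 * j)) (toℕ-fromℕ< half<n) ⟩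
      suc (2 * (toℕ x / 2))            ≡⟨ x≡1+2*half ⟨
      toℕ x                            ∎)
      where open ≡-Reasoning

  nova-¬Hamiltonian : ¬ HamiltonianCycle G
  nova-¬Hamiltonian ham = <-irrefl refl (begin-strict
    2 * n                   <⟨ n<1+n _ ⟩
    order G                 ≤⟨ order≤2*length-cover {G} rim? adj-meets-rim rimVertices rim⊆rimVertices ham ⟩
    2 * length rimVertices  ≡⟨ cong (2 *_) length-rimVertices ⟩
    2 * n                   ∎)
    where open ≤-Reasoning

  RimNeighbourAt : V → ℕ → Set
  RimNeighbourAt x a = Σ V λ o → toℕ o ≡ a × Rim o × Adj G x o

  rimNeighbourAt : ∀ {x} a → a < 2 * n → a % 2 ≡ 1 → toℕ x ≢ a →
                   NovaEdge n (toℕ x) a ⊎ NovaEdge n a (toℕ x) → RimNeighbourAt x a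
  rimNeighbourAt {x} a a<2n a-odd x≢a edge =
    o , o≡a , subst (λ b → b < 2 * n × b % 2 ≡ 1) (sym o≡a) (a<2n , a-odd) ,
    (λ x≡o → x≢a (trans (cong toℕ x≡o) o≡a)) ,
    subst (λ b → NovaEdge n (toℕ x) b ⊎ NovaEdge n b (toℕ x)) (sym o≡a) edge
    where
    o = fromℕ< (m<n⇒m<1+n a<2n)
    o≡a = toℕ-fromℕ< (m<n⇒m<1+n a<2n)

  twoRimNeighbours : ∀ {x a b} → a ≢ b → RimNeighbourAt x a → RimNeighbourAt x b → TwoNeighboursIn {G} Rim x
  twoRimNeighbours a≢b (o , o≡a , Ro , x~o) (o′ , o′≡b , Ro′ , x~o′) =
    o , o′ , (λ o≡o′ → a≢b (trans (sym o≡a) (trans (cong toℕ o≡o′) o′≡b))) , (Ro , x~o) , (Ro′ , x~o′)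

  -- n ≥ 2, written so that 1, 3 and 2n − 1 = 3 + m are visibly rim indices.
  module _ (m : ℕ) (4+m≡2n : 4 + m ≡ 2 * n) where

    3+m<2n : 3 + m < 2 * n
    3+m<2n = ≤-reflexive 4+m≡2n

    1<2n : 1 < 2 * n
    1<2n = ≤-trans (s≤s (s≤s z≤n)) 3+m<2n

    3<2n : 3 < 2 * n
    3<2n = ≤-trans (s≤s (s≤s (s≤s (s≤s z≤n)))) 3+m<2n

    3+m-odd : (3 + m) % 2 ≡ 1
    3+m-odd = even⇒suc-odd m (subst (λ a → a % 2 ≡ 0) (sym 4+m≡2n) (2*-even n))

    successor : ∀ {x} t → toℕ x ≡ t → t < 2 * n → t % 2 ≡ 0 → RimNeighbourAt x (suc t)
    successor t x≡t t<2n t-even =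
      rimNeighbourAt (suc t) 1+t<2n 1+t-odd (λ x≡1+t → 1+n≢n (trans (sym x≡1+t) x≡t))
        (inj₁ (inj₁ (cong suc x≡t , 1+t<2n)))
      where
      1+t-odd = even⇒suc-odd t t-even
      1+t<2n = ≤∧≢⇒< t<2n (odd≢2* n 1+t-odd)

    evenNeighbours : ∀ {x} t → toℕ x ≡ t → t < 2 * n → t % 2 ≡ 0 → TwoNeighboursIn {G} Rim x
    evenNeighbours zero x≡0 0<2n 0-even =
      twoRimNeighbours (λ ()) (successor zero x≡0 0<2n 0-even)
        (rimNeighbourAt (3 + m) 3+m<2n 3+m-odd (λ x≡3+m → 0≢1+n (trans (sym x≡0) x≡3+m))
          (inj₂ (inj₂ (inj₁ (x≡0 , 4+m≡2n)))))
    evenNeighbours (suc t) x≡1+t 1+t<2n 1+t-even =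
      twoRimNeighbours (λ 2+t≡t → <⇒≢ (m<n⇒m<1+n (n<1+n t)) (sym 2+t≡t)) (successor (suc t) x≡1+t 1+t<2n 1+t-even)
        (rimNeighbourAt t (<-trans (n<1+n t) 1+t<2n) (suc-even⇒odd t 1+t-even)
          (λ x≡t → 1+n≢n (trans (sym x≡1+t) x≡t))
          (inj₂ (inj₁ (sym x≡1+t , subst (_< 2 * n) (sym x≡1+t) 1+t<2n))))

    hubNeighbours : ∀ {x} → toℕ x ≡ 2 * n → TwoNeighboursIn {G} Rim x
    hubNeighbours x≡2n =
      twoRimNeighbours (λ ())
        (rimNeighbourAt 1 1<2n refl (λ x≡1 → <⇒≢ 1<2n (trans (sym x≡1) x≡2n)) (inj₁ (inj₂ (inj₂ (inj₂ (x≡2n , refl))))))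
        (rimNeighbourAt 3 3<2n refl (λ x≡3 → <⇒≢ 3<2n (trans (sym x≡3) x≡2n)) (inj₁ (inj₂ (inj₂ (inj₂ (x≡2n , refl))))))

    rim⊎twoNeighbours : ∀ x → Rim x ⊎ TwoNeighboursIn {G} Rim x
    rim⊎twoNeighbours x with m≤n⇒m<n∨m≡n (s≤s⁻¹ (toℕ<n x))
    ... | inj₂ x≡2n = inj₂ (hubNeighbours x≡2n)
    ... | inj₁ x<2n with parity (toℕ x)
    ...   | inj₁ x-even = inj₂ (evenNeighbours (toℕ x) refl x<2n x-even)
    ...   | inj₂ x-odd  = inj₁ (x<2n , x-odd)

    twoConnected : TwoConnected G
    twoConnected = noCutVertex⇒twoConnected (s≤s 1<2n) (noCutVertex-viaClique rim-isClique rim⊎twoNeighbours)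

  nova-twoConnected : 2 ≤ n → TwoConnected G
  nova-twoConnected 2≤n with m , 4+m≡2n ← m≤n⇒∃[o]m+o≡n (*-monoʳ-≤ 2 2≤n) = twoConnected m 4+m≡2n

lemma5 : (TwoConnected snare × ¬ HamiltonianCycle snare)
       × (∀ (n : ℕ) → 2 ≤ n → TwoConnected (nova n) × ¬ HamiltonianCycle (nova n))
lemma5 =
  (snare-twoConnected , snare-¬Hamiltonian) ,
  λ n 2≤n → Nova.nova-twoConnected n 2≤n , Nova.nova-¬Hamiltonian n
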